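{- Let $\Gamma$ be a distance-regular digraph with vertex set $X$ and diameter $D$. Let $0\le i\le D$, $x\in X$, $y\in\Gamma^{\rightarrow}_i(x)$, and $h:=\partial(y,x)$. Then $\partial(z,x)=h$ for every $z\in\Gamma^{\rightarrow}_i(x)$.
   Context: Digraphs are simple and strongly connected. $\partial(x,y)$ is the directed distance; $\Gamma^{\rightarrow}_i(x)=\{z\mid\partial(x,z)=i\}$; $\Gamma^{\rightarrow}_1(y)$, $\Gamma^{\leftarrow}_1(y)$ are the out- and in-neighbourhoods of $y$. $\Gamma$ is a distance-regular digraph if there are integers $d^{\rightarrow}_{ij},d^{\leftarrow}_{ij}$ $(0\le i,j\le D)$ such that for every $x\in X$ and every $y\in\Gamma^{\rightarrow}_i(x)$: $|\Gamma^{\rightarrow}_1(y)\cap\Gamma^{\rightarrow}_j(x)|=d^{\rightarrow}_{ij}$ and $|\Gamma^{\leftarrow}_1(y)\cap\Gamma^{\rightarrow}_j(x)|=d^{\leftarrow}_{ij}$ (i.e., every distance partition $\{\Gamma^{\rightarrow}_0(x),\ldots,\Gamma^{\rightarrow}_D(x)\}$ is equitable with parameters independent of $x$). -}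

module Defs where

open import Data.Nat using (ℕ; zero; suc; _<_; _≤_)
open import Data.Fin using (Fin)
open import Data.List using (List; length)
open import Data.List.Membership.Propositional using (_∈_)
open import Data.List.Relation.Unary.Unique.Propositional using (Unique)
open import Data.Product using (Σ; _×_; ∃; ∃-syntax)
open import Relation.Binary.PropositionalEquality using (_≡_)
open import Relation.Nullary using (¬_)
open import Function.Bundles using (_⇔_)

Digraph : ℕ → Set₁
Digraph n = Fin n → Fin n → Set

Simple : {n : ℕ} → Digraph n → Set
Simple {n} E = (x : Fin n) → ¬ E x x

data Walk {n : ℕ} (E : Digraph n) : Fin n → Fin n → ℕ → Set where
  nil  : ∀ {x} → Walk E x x zero
  cons : ∀ {x y z k} → E x y → Walk E y z k → Walk E x z (suc k)

StronglyConnected : {n : ℕ} → Digraph n → Set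
StronglyConnected {n} E = (x y : Fin n) → ∃[ k ] Walk E x y k

Dist : {n : ℕ} → Digraph n → Fin n → Fin n → ℕ → Set
Dist E x y k = Walk E x y k × ((m : ℕ) → m < k → ¬ Walk E x y m)

IsDiameter : {n : ℕ} → Digraph n → ℕ → Set
IsDiameter {n} E D =
  (Σ (Fin n) λ x → Σ (Fin n) λ y → Dist E x y D)
  × ((x y : Fin n) (k : ℕ) → Dist E x y k → k ≤ D)

HasCard : {n : ℕ} → (Fin n → Set) → ℕ → Set
HasCard {n} P c =
  Σ (List (Fin n)) λ l → Unique l × ((z : Fin n) → (z ∈ l ⇔ P z)) × length l ≡ c

IsDistanceRegularDigraph : {n : ℕ} → Digraph n → ℕ → Set
IsDistanceRegularDigraph {n} E D =
  Simple E × StronglyConnected E × IsDiameter E D ×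
  Σ (ℕ → ℕ → ℕ) λ dOut → Σ (ℕ → ℕ → ℕ) λ dIn →
    (i j : ℕ) → i ≤ D → j ≤ D → (x y : Fin n) → Dist E x y i →
      HasCard (λ z → E y z × Dist E x z j) (dOut i j)
      × HasCard (λ z → E z y × Dist E x z j) (dIn i j)

{-# OPTIONS --safe #-}
-- Going back to x along a shortest walk from y, each step y → y' can be mirrored at z:
-- y and z lie in the same cell Γ→ᵢ(x), so by equitability z has as many out-neighbours
-- in the cell of y' as y has, hence at least one, z'.  Induction on ∂(y,x) gives
-- ∂(z,x) ≤ ∂(y,x), and exchanging y and z gives equality.
module Submission where

open import Defs
open import Data.Nat using (ℕ; zero; suc; _<_; _≤_; z≤n; s≤s; z<s; s<s; _≤?_)
open import Data.Nat.Properties using (≤-refl; ≤-trans; <⇒≤; ≤-antisym; ≮⇒≥; anyUpTo?)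
open import Data.Nat.Induction using (<-wellFounded)
open import Data.Fin using (Fin)
open import Data.Fin.Properties using (_≟_; any?)
open import Data.List using ([]; _∷_)
open import Data.List.Relation.Unary.Any using (here)
open import Data.Product using (_×_; _,_; proj₁; proj₂; ∃; ∃-syntax)
open import Data.Empty using (⊥-elim)
open import Function.Bundles using (Equivalence)
open import Induction.WellFounded using (Acc; acc)
open import Relation.Binary.Definitions using (Decidable)
open import Relation.Binary.PropositionalEquality using (_≡_; refl; subst)
open import Relation.Nullary using (¬_; Dec; yes; no)
open import Relation.Nullary.Decidable using (map′; _×-dec_)

module _ {n : ℕ} {P : Fin n → Set} where

  open import Data.List.Membership.DecPropositional (_≟_ {n}) using (_∈?_)

  HasCard-decidable : ∀ {c} → HasCard P c → ∀ z → Dec (P z)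
  HasCard-decidable (l , _ , iff , _) z =
    map′ (Equivalence.to (iff z)) (Equivalence.from (iff z)) (z ∈? l)

  HasCard-positive : ∀ {c a} → HasCard P c → P a → 0 < c
  HasCard-positive {a = a} ([] , _ , iff , refl) pa with Equivalence.from (iff a) pa
  ... | ()
  HasCard-positive (_ ∷ _ , _ , _ , refl) _ = z<s

  HasCard-witness : ∀ {c} → HasCard P c → 0 < c → ∃ P
  HasCard-witness (a ∷ _ , _ , iff , _) _ = a , Equivalence.to (iff a) (here refl)
  HasCard-witness ([] , _ , _ , refl) ()

module _ {n : ℕ} (E : Digraph n) where

  walk-zero⇒≡ : ∀ {x y} → Walk E x y 0 → x ≡ y
  walk-zero⇒≡ nil = refl

  dist-refl : ∀ x → Dist E x x 0
  dist-refl x = nil , λ _ ()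

  dist-self⇒zero : ∀ {x i} → Dist E x x i → i ≡ 0
  dist-self⇒zero {i = zero} _ = refl
  dist-self⇒zero {i = suc i} (_ , shortest) = ⊥-elim (shortest 0 z<s nil)

  dist≤walk : ∀ {x y h m} → Dist E x y h → Walk E x y m → h ≤ m
  dist≤walk (_ , shortest) w = ≮⇒≥ λ m<h → shortest _ m<h w

  arc⇒dist-one : Simple E → ∀ {x y} → E x y → Dist E x y 1
  arc⇒dist-one simple {x} e = cons e nil , λ { zero z<s nil → simple x e }

  dist-after-arc : ∀ {y y' x h} → Dist E y x (suc h) → E y y' → Walk E y' x h → Dist E y' x h
  dist-after-arc (_ , shortest) e w = w , λ m m<h w' → shortest (suc m) (s<s m<h) (cons e w')

  module _ (arc? : Decidable E) where

    walk? : ∀ m x y → Dec (Walk E x y m)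
    walk? zero x y = map′ (λ { refl → nil }) walk-zero⇒≡ (x ≟ y)
    walk? (suc m) x y =
      map′ (λ (u , e , w) → cons e w) (λ { (cons e w) → _ , e , w })
           (any? λ u → arc? x u ×-dec walk? m u y)

    walk⇒dist : ∀ {x y k} → Walk E x y k → ∃[ j ] j ≤ k × Dist E x y j
    walk⇒dist = go (<-wellFounded _)
      where
      go : ∀ {x y k} → Acc _<_ k → Walk E x y k → ∃[ j ] j ≤ k × Dist E x y j
      go {x} {y} {k} (acc shorter) w with anyUpTo? (λ m → walk? m x y) k
      ... | no none = k , ≤-refl , w , λ m m<k w' → none (m , m<k , w')
      ... | yes (m , m<k , w') with go (shorter m<k) w'
      ...   | j , j≤m , d = j , ≤-trans j≤m (<⇒≤ m<k) , d

module DistanceRegular {n : ℕ} {E : Digraph n} {D : ℕ} (drg : IsDistanceRegularDigraph E D) where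

  private
    simple : Simple E
    simple = proj₁ drg

    dist≤diameter : ∀ {x y k} → Dist E x y k → k ≤ D
    dist≤diameter = proj₂ (proj₁ (proj₂ (proj₂ drg))) _ _ _

    out-count : ℕ → ℕ → ℕ
    out-count = proj₁ (proj₂ (proj₂ (proj₂ drg)))

    out-equitable : ∀ {x y i} j → Dist E x y i → j ≤ D →
                    HasCard (λ z → E y z × Dist E x z j) (out-count i j)
    out-equitable {x} {y} {i} j d j≤D =
      proj₁ (proj₂ (proj₂ (proj₂ (proj₂ (proj₂ drg)))) i j (dist≤diameter d) j≤D x y d)

  -- Shortest walks can only be extracted constructively from decidable arcs; these come from
  -- the cell counts, as the out-neighbours of x form its cell at distance 1.
  arc? : Decidable E
  arc? x y with 1 ≤? D
  ... | no 1≰D = no λ e → 1≰D (dist≤diameter (arc⇒dist-one E simple e))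
  ... | yes 1≤D =
    map′ proj₁ (λ e → e , arc⇒dist-one E simple e)
         (HasCard-decidable (out-equitable 1 (dist-refl E x) 1≤D) y)

  dist-exists : ∀ x y → ∃[ k ] Dist E x y k
  dist-exists x y with walk⇒dist E arc? (proj₂ (proj₁ (proj₂ drg) x y))
  ... | k , _ , d = k , d

  out-neighbour-transfer : ∀ {x y z y' i j} → Dist E x y i → Dist E x z i →
                           E y y' → Dist E x y' j → ∃[ z' ] E z z' × Dist E x z' j
  out-neighbour-transfer dy dz e dy' =
    HasCard-witness (out-equitable _ dz j≤D)
                    (HasCard-positive (out-equitable _ dy j≤D) (e , dy'))
    where j≤D = dist≤diameter dy'

  return-walk-bound : ∀ {x y z i} h → Dist E x y i → Dist E x z i → Dist E y x h →
                      ∃[ m ] m ≤ h × Walk E z x m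
  return-walk-bound zero dy dz (nil , _) with dist-self⇒zero E dy | dz
  ... | refl | nil , _ = 0 , z≤n , nil
  return-walk-bound {x} (suc h) dy dz dyx@(cons {y = y'} e w , _) =
    let j , dy' = dist-exists x y'
        z' , e' , dz' = out-neighbour-transfer dy dz e dy'
        m , m≤h , w' = return-walk-bound h dy' dz' (dist-after-arc E dyx e w)
    in suc m , s≤s m≤h , cons e' w'

lemma4p5 : (n : ℕ) (E : Digraph n) (D : ℕ) → IsDistanceRegularDigraph E D →
    (i : ℕ) → i ≤ D → (x y : Fin n) → Dist E x y i →
    (h : ℕ) → Dist E y x h →
    (z : Fin n) → Dist E x z i → Dist E z x h
-- The hypothesis i ≤ D is redundant: every distance is bounded by the diameter.
lemma4p5 n E D drg i _ x y dy h dyx z dz =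
  let m , m≤h , wzx = return-walk-bound h dy dz dyx
      h' , h'≤m , dzx = walk⇒dist E arc? wzx
      m' , m'≤h' , wyx = return-walk-bound h' dz dy dzx
      h'≤h = ≤-trans h'≤m m≤h
      h≤h' = ≤-trans (dist≤walk E dyx wyx) m'≤h'
  in subst (Dist E z x) (≤-antisym h'≤h h≤h') dzx
  where open DistanceRegular drg
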